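{- A prime tournament $G$ with $|V(G)|\ge 3$ has no subtournament isomorphic to $D_4$ if and only if $G$ is isomorphic to $T_n$ for some odd $n\ge 3$.
   Context: A tournament has exactly one directed edge between any two distinct vertices. A homogeneous set of $G$ is $X\subseteq V(G)$ such that each $v\notin X$ either beats all of $X$ or is beaten by all of $X$; it is nontrivial if $1<|X|<|V(G)|$; $G$ is prime if it has no nontrivial homogeneous set. $D_4$ is the 4-vertex tournament consisting of a cyclic triangle $C$ and a vertex $v$ with $v\to c$ for all $c\in C$. For odd $n=2k+1$, $T_n$ has vertices $v_1,\dots,v_n$ with $v_i\to v_j$ iff $j\equiv i+1,\dots,i+k\pmod n$. -}

module Defs where

open import Data.Nat using (ℕ; zero; suc; _+_; _*_; _∸_; _<_; _≤_; _≤ᵇ_)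
open import Data.Nat.DivMod using (_%_)
open import Data.Bool using (Bool; true; false; not; _∧_)
open import Data.Fin using (Fin; toℕ)
open import Data.Fin.Subset using (Subset; _∈_; _∉_; ∣_∣)
open import Data.Product using (Σ; _×_; _,_; ∃)
open import Relation.Binary.PropositionalEquality using (_≡_; _≢_)
open import Function.Bundles using (_⤖_; Func)
open import Function.Definitions using (Injective)

-- A tournament on vertex set Fin n: adj u v ≡ true means u → v (u beats v).
record Tournament (n : ℕ) : Set where
  field
    adj     : Fin n → Fin n → Bool
    irrefl  : ∀ u → adj u u ≡ false
    tourn   : ∀ u v → u ≢ v → adj v u ≡ not (adj u v)
open Tournament public

∣V∣ : ∀ {n} → Tournament n → ℕ
∣V∣ {n} _ = n

Homogeneous : ∀ {n} → Tournament n → Subset n → Set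
Homogeneous G X =
  ∀ v → v ∉ X →
    ((∀ x → x ∈ X → adj G v x ≡ true) ⊎′ (∀ x → x ∈ X → adj G x v ≡ true))
  where
  open import Data.Sum using () renaming (_⊎_ to _⊎′_)

NontrivialHomogeneous : ∀ {n} → Tournament n → Subset n → Set
NontrivialHomogeneous {n} G X = Homogeneous G X × (1 < ∣ X ∣) × (∣ X ∣ < n)

Prime : ∀ {n} → Tournament n → Set
Prime {n} G = ∀ (X : Subset n) → ¬′ (NontrivialHomogeneous G X)
  where
  open import Relation.Nullary using () renaming (¬_ to ¬′_)

IsoTo : ∀ {n m} → Tournament n → (Fin m → Fin m → Bool) → Set
IsoTo {n} {m} G Hadj =
  Σ (Fin n ⤖ Fin m) λ φ →
    ∀ u v → Hadj (Bijection.to φ u) (Bijection.to φ v) ≡ adj G u v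
  where
  open import Function.Bundles using (Bijection)

-- G contains a subtournament isomorphic to the tournament on Fin m with
-- adjacency Hadj: an injective vertex map f preserving adjacency (so the
-- subtournament induced on the image of f is isomorphic to it).
ContainsSub : ∀ {n m} → Tournament n → (Fin m → Fin m → Bool) → Set
ContainsSub {n} {m} G Hadj =
  Σ (Fin m → Fin n) λ f → Injective _≡_ _≡_ f × (∀ u v → adj G (f u) (f v) ≡ Hadj u v)

D4adj : Fin 4 → Fin 4 → Bool
D4adj i j = dadj (toℕ i) (toℕ j)
  where
  dadj : ℕ → ℕ → Bool
  dadj 0 1 = true
  dadj 0 2 = true
  dadj 0 3 = true
  dadj 1 2 = true
  dadj 2 3 = true
  dadj 3 1 = true
  dadj _ _ = false

-- T_n for n = 2k+1 on vertices Fin n (v_{i+1} ↔ index i):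
-- i → j iff (j - i) mod n ∈ {1, …, k}.
Tadj : (k : ℕ) → Fin (suc (2 * k)) → Fin (suc (2 * k)) → Bool
Tadj k i j = (1 ≤ᵇ d) ∧ (d ≤ᵇ k)
  where
  d : ℕ
  d = ((toℕ j + suc (2 * k)) ∸ toℕ i) % suc (2 * k)

module Submission where

-- In a D4-free tournament every out-neighbourhood N⁺(v) is transitive, so it has a source σ v.
-- Primeness adds that no cyclic triangle has a common out-neighbour, and from this one shows
-- inductively that N⁺(v) = {σ v, σ² v, …, σᵏ v} for some k = k(v) that does not decrease along σ.
-- On the σ-orbit W of a vertex maximising k, the out-neighbours of W j are exactly
-- W (j + 1), …, W (j + k); this forces W to have period 2k + 1 and to carry the adjacency of
-- T_{2k+1}, and since the orbit is closed under out-neighbours, primeness makes it all of G.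
-- Conversely, in T_n the out-neighbours of a vertex x are ordered by their distance from x in a
-- way every edge between them respects, so x cannot dominate a cyclic triangle.

open import Defs
open import Data.Nat using (ℕ; zero; suc; _+_; _*_; _∸_; _≤_; _<_; z≤n; s≤s; s≤s⁻¹; _≤ᵇ_; _≤?_; NonZero)
open import Data.Nat.DivMod
  using (_%_; _/_; m%n<n; m%n%n≡m%n; [m+n]%n≡m%n; m<n⇒m%n≡m; %-distribˡ-+; m≡m%n+[m/n]*n)
open import Data.Nat.Tactic.RingSolver using (solve-∀)
open import Data.Nat.Properties
open import Data.Bool using (Bool; true; false; not; _∧_)
open import Data.Bool.Properties using (T-∧; T-≡) renaming (_≟_ to _≟ᵇ_)
open import Data.Fin using (Fin; zero; suc; toℕ; fromℕ<; punchIn; #_)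
open import Data.Fin.Properties
  using (punchInᵢ≢i; punchIn-injective; any?; toℕ<n; toℕ-fromℕ<; toℕ-injective) renaming (_≟_ to _≟ᶠ_)
open import Data.Fin.Subset using (Subset; _∈_; _∉_; ∣_∣; ⁅_⁆; ⊤; _─_; _-_; inside; outside)
open import Data.Fin.Subset.Properties using (p⊂q⇒∣p∣<∣q∣; ∣⁅x⁆∣≡1; ∣⊤∣≡n; ∈⊤; x∈⁅y⁆⇒x≡y; x≢y⇒x∉⁅y⁆; x∈⁅x⁆;
  p─q⊆p; x∈p∧x≢y⇒x∈p-y; x∈p⇒∣p-x∣<∣p∣; _∈?_; nonempty?)
open import Data.Vec using (tabulate; lookup; _∷_; []; here; there)
open import Data.Vec.Properties using (lookup∘tabulate; []=⇒lookup; lookup⇒[]=)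
open import Data.Product using (Σ; _×_; _,_; ∃-syntax; proj₁; proj₂)
open import Data.Sum using (_⊎_; inj₁; inj₂; [_,_])
open import Data.Empty using (⊥; ⊥-elim)
open import Data.List using (List; []; _∷_; allFin)
open import Data.List.Extrema.Nat using (argmax; f[xs]≤f[argmax])
open import Data.List.Relation.Unary.All as All using ()
open import Data.List.Membership.Propositional using () renaming (_∈_ to _∈ₗ_)
open import Data.List.Membership.Propositional.Properties using (∈-allFin)
open import Data.List.Relation.Unary.Any using () renaming (here to hereₗ; there to thereₗ)
open import Level using (Level)
open import Relation.Unary using (Pred; Decidable)
open import Relation.Nullary using (¬_; Dec; yes; no; does; contradiction)
open import Relation.Nullary.Reflects using (ofʸ; ofⁿ)
open import Relation.Binary.Definitions using (tri<; tri≈; tri>)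
open import Relation.Nullary.Decidable using (dec-true; ¬?; _×-dec_; _⊎-dec_; decidable-stable)
open import Relation.Binary.PropositionalEquality
  using (_≡_; _≢_; refl; sym; trans; cong; cong₂; subst; module ≡-Reasoning)
open import Function using (_∘_; case_of_)
open import Function.Bundles using (mk⤖; Equivalence; Bijection; _⇔_; mk⇔)
open import Function.Definitions using (Injective)

private
  variable
    ℓ : Level
    m n : ℕ

module _ {P : Pred (Fin n) ℓ} (P? : Decidable P) where

  ⟦_⟧ : Subset n
  ⟦_⟧ = tabulate (λ x → does (P? x))

  ∈⟦⟧⁺ : ∀ {x} → P x → x ∈ ⟦_⟧
  ∈⟦⟧⁺ {x} px = lookup⇒[]= x _ (trans (lookup∘tabulate _ x) (dec-true (P? x) px))

  ∈⟦⟧⁻ : ∀ {x} → x ∈ ⟦_⟧ → P x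
  ∈⟦⟧⁻ {x} x∈ with P? x | trans (sym (lookup∘tabulate (λ x → does (P? x)) x)) ([]=⇒lookup x∈)
  ... | yes px | _ = px
  ... | no _ | ()

1<∣p∣ : ∀ {p : Subset n} {x y} → x ∈ p → y ∈ p → x ≢ y → 1 < ∣ p ∣
1<∣p∣ {p = p} {x} {y} x∈p y∈p x≢y =
  subst (_< ∣ p ∣) (∣⁅x⁆∣≡1 x) (p⊂q⇒∣p∣<∣q∣ (⁅x⁆⊆p , y , y∈p , x≢y⇒x∉⁅y⁆ (x≢y ∘ sym)))
  where
  ⁅x⁆⊆p : ∀ {z} → z ∈ ⁅ x ⁆ → z ∈ p
  ⁅x⁆⊆p z∈ = subst (_∈ p) (sym (x∈⁅y⁆⇒x≡y x z∈)) x∈p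

x∈p─q⇒x∉q : ∀ (p q : Subset n) {x} → x ∈ p ─ q → x ∉ q
x∈p─q⇒x∉q (_ ∷ _) (inside ∷ _) () here
x∈p─q⇒x∉q (_ ∷ _) (outside ∷ _) here ()
x∈p─q⇒x∉q (_ ∷ p) (_ ∷ q) (there x∈p─q) (there x∈q) = x∈p─q⇒x∉q p q x∈p─q x∈q

x∈p-y⇒x≢y : ∀ {p : Subset n} {x y} → x ∈ p - y → x ≢ y
x∈p-y⇒x≢y {p = p} {y = y} x∈p-y refl = x∈p─q⇒x∉q p ⁅ y ⁆ x∈p-y (x∈⁅x⁆ y)

∣p∣<n : ∀ {p : Subset n} {x} → x ∉ p → ∣ p ∣ < n
∣p∣<n {n} {p} {x} x∉p = subst (∣ p ∣ <_) (∣⊤∣≡n n) (p⊂q⇒∣p∣<∣q∣ ((λ _ → ∈⊤) , x , ∈⊤ , x∉p))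

two-others : 3 ≤ n → (v : Fin n) → ∃[ a ] ∃[ b ] a ≢ b × a ≢ v × b ≢ v
two-others {suc (suc (suc n))} (s≤s (s≤s (s≤s _))) v =
  punchIn v zero , punchIn v (suc zero) ,
  (λ e → contradiction (punchIn-injective v zero (suc zero) e) λ ()) ,
  punchInᵢ≢i v zero , punchInᵢ≢i v (suc zero)

avoid-two : 3 ≤ n → (u v : Fin n) → ∃[ c ] c ≢ u × c ≢ v
avoid-two 3≤n u v with two-others 3≤n u
... | a , b , a≢b , a≢u , b≢u with a ≟ᶠ v
...   | no a≢v = a , a≢u , a≢v
...   | yes refl = b , b≢u , a≢b ∘ sym

module TournamentFacts {n} (G : Tournament n) where

  infix 4 _⟶_ _⟶?_
  _⟶_ : Fin n → Fin n → Set
  u ⟶ v = adj G u v ≡ true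

  _⟶?_ : ∀ u v → Dec (u ⟶ v)
  u ⟶? v = adj G u v ≟ᵇ true

  ⟶-irrefl : ∀ {u} → ¬ (u ⟶ u)
  ⟶-irrefl {u} u⟶u with () ← trans (sym (irrefl G u)) u⟶u

  ⟶⇒≢ : ∀ {u v} → u ⟶ v → u ≢ v
  ⟶⇒≢ u⟶u refl = ⟶-irrefl u⟶u

  ⟶⇒adj-false : ∀ {u v} → u ⟶ v → adj G v u ≡ false
  ⟶⇒adj-false {u} {v} u⟶v = trans (tourn G u v (⟶⇒≢ u⟶v)) (cong not u⟶v)

  ⟶-asym : ∀ {u v} → u ⟶ v → ¬ (v ⟶ u)
  ⟶-asym u⟶v v⟶u with () ← trans (sym (⟶⇒adj-false u⟶v)) v⟶u

  ⟶-total : ∀ {u v} → u ≢ v → u ⟶ v ⊎ v ⟶ u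
  ⟶-total {u} {v} u≢v with adj G u v in uv
  ... | true = inj₁ refl
  ... | false = inj₂ (trans (tourn G u v u≢v) (cong not uv))

  Homogeneousᴾ : Pred (Fin n) ℓ → Set ℓ
  Homogeneousᴾ P = ∀ v → ¬ P v → (∀ x → P x → v ⟶ x) ⊎ (∀ x → P x → x ⟶ v)

  prime⇒homogeneousᴾ-trivial : Prime G → ∀ {P : Pred (Fin n) ℓ} → Decidable P → Homogeneousᴾ P →
                               ∀ {a b c} → P a → P b → a ≢ b → ¬ P c → ⊥
  prime⇒homogeneousᴾ-trivial prime P? homogeneous pa pb a≢b ¬pc =
    prime ⟦ P? ⟧ (homogeneous′ , 1<∣p∣ (∈⟦⟧⁺ P? pa) (∈⟦⟧⁺ P? pb) a≢b , ∣p∣<n (¬pc ∘ ∈⟦⟧⁻ P?))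
    where
    homogeneous′ : Homogeneous G ⟦ P? ⟧
    homogeneous′ v v∉ with homogeneous v (v∉ ∘ ∈⟦⟧⁺ P?)
    ... | inj₁ v⟶P = inj₁ (λ x x∈ → v⟶P x (∈⟦⟧⁻ P? x∈))
    ... | inj₂ P⟶v = inj₂ (λ x x∈ → P⟶v x (∈⟦⟧⁻ P? x∈))

  adj-preserving⇒injective : ∀ {m} {H : Fin m → Fin m → Bool} (f : Fin m → Fin n) →
    (∀ i j → adj G (f i) (f j) ≡ H i j) → (∀ i j → H i j ≡ false → H j i ≡ false → i ≡ j) →
    Injective _≡_ _≡_ f
  adj-preserving⇒injective f preserves loopless {i} {j} fi≡fj = loopless i j
    (trans (sym (preserves i j)) (trans (cong (adj G (f i)) (sym fi≡fj)) (irrefl G (f i))))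
    (trans (sym (preserves j i)) (trans (cong (adj G (f j)) fi≡fj) (irrefl G (f j))))

  dominated-cyclic-triangle⇒D4 : ∀ {x a b c} → x ⟶ a → x ⟶ b → x ⟶ c → a ⟶ b → b ⟶ c → c ⟶ a →
                                ContainsSub G D4adj
  dominated-cyclic-triangle⇒D4 {x} {a} {b} {c} x⟶a x⟶b x⟶c a⟶b b⟶c c⟶a =
    f , adj-preserving⇒injective f preserves loopless , preserves
    where
    f : Fin 4 → Fin n
    f = lookup (x ∷ a ∷ b ∷ c ∷ [])
    preserves : ∀ i j → adj G (f i) (f j) ≡ D4adj i j
    preserves zero zero = irrefl G x
    preserves zero (suc zero) = x⟶a
    preserves zero (suc (suc zero)) = x⟶b
    preserves zero (suc (suc (suc zero))) = x⟶c
    preserves (suc zero) zero = ⟶⇒adj-false x⟶a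
    preserves (suc zero) (suc zero) = irrefl G a
    preserves (suc zero) (suc (suc zero)) = a⟶b
    preserves (suc zero) (suc (suc (suc zero))) = ⟶⇒adj-false c⟶a
    preserves (suc (suc zero)) zero = ⟶⇒adj-false x⟶b
    preserves (suc (suc zero)) (suc zero) = ⟶⇒adj-false a⟶b
    preserves (suc (suc zero)) (suc (suc zero)) = irrefl G b
    preserves (suc (suc zero)) (suc (suc (suc zero))) = b⟶c
    preserves (suc (suc (suc zero))) zero = ⟶⇒adj-false x⟶c
    preserves (suc (suc (suc zero))) (suc zero) = c⟶a
    preserves (suc (suc (suc zero))) (suc (suc zero)) = ⟶⇒adj-false b⟶c
    preserves (suc (suc (suc zero))) (suc (suc (suc zero))) = irrefl G c
    loopless : ∀ i j → D4adj i j ≡ false → D4adj j i ≡ false → i ≡ j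
    loopless zero zero _ _ = refl
    loopless (suc zero) (suc zero) _ _ = refl
    loopless (suc (suc zero)) (suc (suc zero)) _ _ = refl
    loopless (suc (suc (suc zero))) (suc (suc (suc zero))) _ _ = refl
    loopless zero (suc zero) () _
    loopless zero (suc (suc zero)) () _
    loopless zero (suc (suc (suc zero))) () _
    loopless (suc zero) zero _ ()
    loopless (suc zero) (suc (suc zero)) () _
    loopless (suc zero) (suc (suc (suc zero))) _ ()
    loopless (suc (suc zero)) zero _ ()
    loopless (suc (suc zero)) (suc zero) _ ()
    loopless (suc (suc zero)) (suc (suc (suc zero))) () _
    loopless (suc (suc (suc zero))) zero _ ()
    loopless (suc (suc (suc zero))) (suc zero) () _
    loopless (suc (suc (suc zero))) (suc (suc zero)) _ ()

  ⟶⟶⇒≢ : ∀ {u v w} → u ⟶ v → v ⟶ w → u ≢ w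
  ⟶⟶⇒≢ u⟶v v⟶u refl = ⟶-asym u⟶v v⟶u

  module _ {S : Pred (Fin n) ℓ} (S? : Decidable S)
           (acyclic : ∀ {a b c} → S a → S b → S c → a ⟶ b → b ⟶ c → c ⟶ a → ⊥) where

    Source : List (Fin n) → Set ℓ
    Source L = ∃[ s ] S s × (∀ y → y ∈ₗ L → S y → y ≢ s → s ⟶ y)

    source-or-disjoint : ∀ L → (∀ y → y ∈ₗ L → ¬ S y) ⊎ Source L
    source-or-disjoint [] = inj₁ (λ _ ())
    source-or-disjoint (x ∷ L) with source-or-disjoint L | S? x
    ... | inj₁ disjoint | no ¬Sx = inj₁ λ { _ (hereₗ refl) → ¬Sx ; y (thereₗ y∈L) → disjoint y y∈L }
    ... | inj₁ disjoint | yes Sx = inj₂ (x , Sx , λ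
      { _ (hereₗ refl) _ x≢x → contradiction refl x≢x
      ; y (thereₗ y∈L) Sy _ → contradiction Sy (disjoint y y∈L) })
    ... | inj₂ (s , Ss , s-beats) | no ¬Sx = inj₂ (s , Ss , λ
      { _ (hereₗ refl) Sx _ → contradiction Sx ¬Sx
      ; y (thereₗ y∈L) → s-beats y y∈L })
    ... | inj₂ (s , Ss , s-beats) | yes Sx with x ≟ᶠ s
    ...   | yes refl = inj₂ (s , Ss , λ
      { _ (hereₗ refl) _ s≢s → contradiction refl s≢s
      ; y (thereₗ y∈L) → s-beats y y∈L })
    ...   | no x≢s with ⟶-total (x≢s ∘ sym)
    ...     | inj₁ s⟶x = inj₂ (s , Ss , λ
      { _ (hereₗ refl) _ _ → s⟶x
      ; y (thereₗ y∈L) → s-beats y y∈L })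
    ...     | inj₂ x⟶s = inj₂ (x , Sx , x-beats)
      where
      x-beats : ∀ y → y ∈ₗ x ∷ L → S y → y ≢ x → x ⟶ y
      x-beats _ (hereₗ refl) _ x≢x = contradiction refl x≢x
      x-beats y (thereₗ y∈L) Sy y≢x with y ≟ᶠ s
      ... | yes refl = x⟶s
      ... | no y≢s with ⟶-total (y≢x ∘ sym)
      ...   | inj₁ x⟶y = x⟶y
      ...   | inj₂ y⟶x = ⊥-elim (acyclic Ss Sy Sx (s-beats y y∈L Sy y≢s) y⟶x x⟶s)

    source : ∀ {x} → S x → ∃[ s ] S s × (∀ y → S y → y ≢ s → s ⟶ y)
    source {x} Sx with source-or-disjoint (allFin n)
    ... | inj₁ disjoint = contradiction Sx (disjoint x (∈-allFin x))
    ... | inj₂ (s , Ss , s-beats) = s , Ss , λ y → s-beats y (∈-allFin y)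

  out-closed⇒full : Prime G → ∀ {P : Pred (Fin n) ℓ} → Decidable P →
                    (∀ {y z} → P y → y ⟶ z → P z) → ∀ {a b} → P a → P b → a ≢ b → ∀ x → P x
  out-closed⇒full prime {P} P? closed pa pb a≢b x with P? x
  ... | yes px = px
  ... | no ¬px = ⊥-elim (prime⇒homogeneousᴾ-trivial prime P? beats-P pa pb a≢b ¬px)
    where
    beats-P : Homogeneousᴾ P
    beats-P z ¬pz = inj₁ λ y py → case ⟶-total (λ { refl → ¬pz py }) of λ
      { (inj₁ z⟶y) → z⟶y
      ; (inj₂ y⟶z) → contradiction (closed py y⟶z) ¬pz }

  OutSegment : Fin n → (ℕ → Fin n) → ℕ → Set
  OutSegment v f k = (∀ i → 1 ≤ i → i ≤ k → v ⟶ f i) ×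
                     (∀ x → v ⟶ x → ∃[ i ] 1 ≤ i × i ≤ k × x ≡ f i)

  OutSegment-cong : ∀ {v f g k} → (∀ i → f i ≡ g i) → OutSegment v f k → OutSegment v g k
  OutSegment-cong {v} f≗g (first , only) =
    (λ i 1≤i i≤k → subst (v ⟶_) (f≗g i) (first i 1≤i i≤k)) ,
    (λ x v⟶x → let (i , 1≤i , i≤k , x≡) = only x v⟶x in i , 1≤i , i≤k , trans x≡ (f≗g i))

  enumeration⇒IsoTo : ∀ {m} {H : Fin m → Fin m → Bool} (ψ : Fin m → Fin n) →
    Injective _≡_ _≡_ ψ → (∀ x → ∃[ i ] ψ i ≡ x) → (∀ i j → H i j ≡ adj G (ψ i) (ψ j)) → IsoTo G H
  enumeration⇒IsoTo {H = H} ψ ψ-injective ψ-onto ψ-preserves =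
    mk⤖ {to = φ} (φ-injective , λ i → ψ i , λ { refl → ψ-injective (ψφ (ψ i)) }) , φ-preserves
    where
    φ : Fin n → Fin _
    φ x = proj₁ (ψ-onto x)
    ψφ : ∀ x → ψ (φ x) ≡ x
    ψφ x = proj₂ (ψ-onto x)
    φ-injective : Injective _≡_ _≡_ φ
    φ-injective {x} {y} φx≡φy = trans (sym (ψφ x)) (trans (cong ψ φx≡φy) (ψφ y))
    φ-preserves : ∀ u v → H (φ u) (φ v) ≡ adj G u v
    φ-preserves u v = trans (ψ-preserves (φ u) (φ v)) (cong₂ (adj G) (ψφ u) (ψφ v))

module _ {d : ℕ} .{{_ : NonZero d}} where

  %-absorbˡ : ∀ a b → (a % d + b) % d ≡ (a + b) % d
  %-absorbˡ a b = begin
    (a % d + b) % d          ≡⟨ %-distribˡ-+ (a % d) b d ⟩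
    (a % d % d + b % d) % d  ≡⟨ cong (λ t → (t + b % d) % d) (m%n%n≡m%n a d) ⟩
    (a % d + b % d) % d      ≡⟨ %-distribˡ-+ a b d ⟨
    (a + b) % d              ∎
    where open ≡-Reasoning

  %-absorbʳ : ∀ a b → (a + b % d) % d ≡ (a + b) % d
  %-absorbʳ a b = begin
    (a + b % d) % d  ≡⟨ cong (_% d) (+-comm a (b % d)) ⟩
    (b % d + a) % d  ≡⟨ %-absorbˡ b a ⟩
    (b + a) % d      ≡⟨ cong (_% d) (+-comm b a) ⟩
    (a + b) % d      ∎
    where open ≡-Reasoning

  +-cancelʳ-% : ∀ {x r s} → x ≤ d → r < d → s < d → (r + x) % d ≡ (s + x) % d → r ≡ s
  +-cancelʳ-% {x} {r} {s} x≤d r<d s<d eq = begin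
    r                             ≡⟨ m<n⇒m%n≡m r<d ⟨
    r % d                         ≡⟨ unshift r ⟨
    ((r + x) % d + (d ∸ x)) % d   ≡⟨ cong (λ t → (t + (d ∸ x)) % d) eq ⟩
    ((s + x) % d + (d ∸ x)) % d   ≡⟨ unshift s ⟩
    s % d                         ≡⟨ m<n⇒m%n≡m s<d ⟩
    s                             ∎
    where
    open ≡-Reasoning
    unshift : ∀ t → ((t + x) % d + (d ∸ x)) % d ≡ t % d
    unshift t = begin
      ((t + x) % d + (d ∸ x)) % d  ≡⟨ %-absorbˡ (t + x) (d ∸ x) ⟩
      (t + x + (d ∸ x)) % d        ≡⟨ cong (_% d) (+-assoc t x (d ∸ x)) ⟩
      (t + (x + (d ∸ x))) % d      ≡⟨ cong (λ e → (t + e) % d) (m+[n∸m]≡n x≤d) ⟩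
      (t + d) % d                  ≡⟨ [m+n]%n≡m%n t d ⟩
      t % d                        ∎

-- (j − i) mod (m + 1), written exactly as in Tadj so that Tadj k i j unfolds to a test on gap i j.
gap : Fin (suc m) → Fin (suc m) → ℕ
gap {m} i j = ((toℕ j + suc m) ∸ toℕ i) % suc m

module _ {m : ℕ} where

  gap< : ∀ (i j : Fin (suc m)) → gap i j < suc m
  gap< i j = m%n<n ((toℕ j + suc m) ∸ toℕ i) (suc m)

  gap-spec : ∀ (i j : Fin (suc m)) → (gap i j + toℕ i) % suc m ≡ toℕ j
  gap-spec i j = begin
    (((toℕ j + suc m) ∸ toℕ i) % suc m + toℕ i) % suc m  ≡⟨ %-absorbˡ ((toℕ j + suc m) ∸ toℕ i) (toℕ i) ⟩
    ((toℕ j + suc m) ∸ toℕ i + toℕ i) % suc m            ≡⟨ cong (_% suc m) (m∸n+n≡m i≤j+1+m) ⟩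
    (toℕ j + suc m) % suc m                              ≡⟨ [m+n]%n≡m%n (toℕ j) (suc m) ⟩
    toℕ j % suc m                                        ≡⟨ m<n⇒m%n≡m (toℕ<n j) ⟩
    toℕ j                                                ∎
    where
    open ≡-Reasoning
    i≤j+1+m : toℕ i ≤ toℕ j + suc m
    i≤j+1+m = m≤n⇒m≤o+n (toℕ j) (<⇒≤ (toℕ<n i))

  gap-unique : ∀ {r} (i j : Fin (suc m)) → r < suc m → (r + toℕ i) % suc m ≡ toℕ j → r ≡ gap i j
  gap-unique i j r<1+m eq =
    +-cancelʳ-% (<⇒≤ (toℕ<n i)) r<1+m (gap< i j) (trans eq (sym (gap-spec i j)))

  gap-additive : ∀ (i j l : Fin (suc m)) → gap j l + gap i j < suc m → gap j l + gap i j ≡ gap i l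
  gap-additive i j l sum<1+m = gap-unique i l sum<1+m (begin
    (gap j l + gap i j + toℕ i) % suc m          ≡⟨ cong (_% suc m) (+-assoc (gap j l) (gap i j) (toℕ i)) ⟩
    (gap j l + (gap i j + toℕ i)) % suc m        ≡⟨ %-absorbʳ (gap j l) (gap i j + toℕ i) ⟨
    (gap j l + (gap i j + toℕ i) % suc m) % suc m ≡⟨ cong (λ t → (gap j l + t) % suc m) (gap-spec i j) ⟩
    (gap j l + toℕ j) % suc m                     ≡⟨ gap-spec j l ⟩
    toℕ l                                         ∎)
    where open ≡-Reasoning

Tadj⇒gap-bounds : ∀ k (i j : Fin (suc (2 * k))) → Tadj k i j ≡ true → 1 ≤ gap i j × gap i j ≤ k
Tadj⇒gap-bounds k i j Tij with Equivalence.to T-∧ (Equivalence.from T-≡ Tij)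
... | 1≤ᵇgap , gap≤ᵇk = ≤ᵇ⇒≤ 1 (gap i j) 1≤ᵇgap , ≤ᵇ⇒≤ (gap i j) k gap≤ᵇk

Tadj-out-ordered : ∀ k (x y z : Fin (suc (2 * k))) →
  Tadj k x y ≡ true → Tadj k x z ≡ true → Tadj k y z ≡ true → gap x y < gap x z
Tadj-out-ordered k x y z Txy _ Tyz =
  subst (gap x y <_) (gap-additive x y z sum<M) (m<n+m (gap x y) (proj₁ (Tadj⇒gap-bounds k y z Tyz)))
  where
  sum<M : gap y z + gap x y < suc (2 * k)
  sum<M = s≤s (subst (gap y z + gap x y ≤_) (cong (k +_) (sym (+-identityʳ k)))
                     (+-mono-≤ (proj₂ (Tadj⇒gap-bounds k y z Tyz)) (proj₂ (Tadj⇒gap-bounds k x y Txy))))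

module Rotation {n} (G : Tournament n) (k : ℕ) (1≤k : 1 ≤ k) (W : ℕ → Fin n)
                (window : ∀ j → TournamentFacts.OutSegment G (W j) (λ i → W (i + j)) k) where

  open TournamentFacts G

  M : ℕ
  M = suc (2 * k)

  window⁺ : ∀ {a b} → a < b → b ≤ k + a → W a ⟶ W b
  window⁺ {a} {b} a<b b≤k+a = subst (λ c → W a ⟶ W c) (m∸n+n≡m (<⇒≤ a<b))
    (proj₁ (window a) (b ∸ a) (m<n⇒0<n∸m a<b) (subst (b ∸ a ≤_) (m+n∸n≡m k a) (∸-monoˡ-≤ a b≤k+a)))

  window⁻ : ∀ {a x} → W a ⟶ x → ∃[ b ] a < b × b ≤ k + a × x ≡ W b
  window⁻ {a} Wa⟶x with proj₂ (window a) _ Wa⟶x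
  ... | i , 1≤i , i≤k , x≡ = i + a , m<n+m a 1≤i , +-monoˡ-≤ a i≤k , x≡

  W-≢ : ∀ {a b} → a < b → b ≤ k + (k + a) → W a ≢ W b
  W-≢ {a} {b} a<b b≤ Wa≡Wb with b ≤? k + a
  ... | yes b≤k+a = ⟶-irrefl (subst (W a ⟶_) (sym Wa≡Wb) (window⁺ a<b b≤k+a))
  ... | no b≰k+a = ⟶-asym (window⁺ a<c c≤k+a) (subst (W c ⟶_) (trans (cong W k+c≡b) (sym Wa≡Wb)) c⟶k+c)
    where
    c = b ∸ k
    k+c≡b : k + c ≡ b
    k+c≡b = m+[n∸m]≡n (≤-trans (m≤m+n k a) (<⇒≤ (≰⇒> b≰k+a)))
    a<c : a < c
    a<c = +-cancelˡ-< k a c (subst (k + a <_) (sym k+c≡b) (≰⇒> b≰k+a))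
    c≤k+a : c ≤ k + a
    c≤k+a = +-cancelˡ-≤ k c (k + a) (subst (_≤ k + (k + a)) (sym k+c≡b) b≤)
    c⟶k+c : W c ⟶ W (k + c)
    c⟶k+c = window⁺ (m<n+m c 1≤k) ≤-refl

  -- W (1 + k + j) is too far ahead to be beaten by W j, so it beats W j, and by the same
  -- windows W j can only be the k-th vertex after it.
  W-period : ∀ j → W (M + j) ≡ W j
  W-period j with ⟶-total (W-≢ (m<n+m j (s≤s z≤n)) (+-monoˡ-≤ (k + j) 1≤k))
  ... | inj₁ Wj⟶u with window⁻ Wj⟶u
  ...   | b , j<b , b≤k+j , u≡Wb = contradiction (sym u≡Wb) (W-≢ (s≤s b≤k+j) 1+k+j≤k+[k+b])
    where
    1+k+j≤k+[k+b] : suc k + j ≤ k + (k + b)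
    1+k+j≤k+[k+b] = ≤-trans (≤-reflexive (sym (+-suc k j)))
                            (+-monoʳ-≤ k (≤-trans j<b (m≤n+m b k)))
  W-period j | inj₂ u⟶Wj with window⁻ u⟶Wj
  ... | b , 1+k+j<b , b≤ , Wj≡Wb with m≤n⇒m<n∨m≡n b≤
  ...   | inj₁ b<k+[1+k+j] = contradiction Wj≡Wb
          (W-≢ (<-trans (m<n+m j (s≤s z≤n)) 1+k+j<b) (s≤s⁻¹ (subst (b <_) (+-suc k (k + j)) b<k+[1+k+j])))
  ...   | inj₂ refl = trans (cong W (M+j≡k+[1+k+j] k j)) (sym Wj≡Wb)
    where
    M+j≡k+[1+k+j] : ∀ k j → suc (2 * k) + j ≡ k + (suc k + j)
    M+j≡k+[1+k+j] = solve-∀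

  W-periodic : ∀ q j → W (q * M + j) ≡ W j
  W-periodic zero j = refl
  W-periodic (suc q) j =
    trans (cong W (+-assoc M (q * M) j)) (trans (W-period (q * M + j)) (W-periodic q j))

  W-mod : ∀ j → W j ≡ W (j % M)
  W-mod j = begin
    W j                        ≡⟨ cong W (m≡m%n+[m/n]*n j M) ⟩
    W (j % M + (j / M) * M)    ≡⟨ cong W (+-comm (j % M) _) ⟩
    W ((j / M) * M + j % M)    ≡⟨ W-periodic (j / M) (j % M) ⟩
    W (j % M)                  ∎
    where open ≡-Reasoning

  W-in-range : ∀ j → ∃[ i ] W (toℕ i) ≡ W j
  W-in-range j = fromℕ< (m%n<n j M) , trans (cong W (toℕ-fromℕ< (m%n<n j M))) (sym (W-mod j))

  toℕ≤k+[k+_] : ∀ b (i : Fin M) → toℕ i ≤ k + (k + b)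
  toℕ≤k+[k+ b ] i = ≤-trans (s≤s⁻¹ (toℕ<n i)) (+-monoʳ-≤ k (+-monoʳ-≤ k z≤n))

  W-injective : Injective _≡_ _≡_ (λ (i : Fin M) → W (toℕ i))
  W-injective {i} {j} Wi≡Wj with <-cmp (toℕ i) (toℕ j)
  ... | tri< i<j _ _ = contradiction Wi≡Wj (W-≢ i<j (toℕ≤k+[k+ toℕ i ] j))
  ... | tri≈ _ i≡j _ = toℕ-injective i≡j
  ... | tri> _ _ j<i = contradiction (sym Wi≡Wj) (W-≢ j<i (toℕ≤k+[k+ toℕ j ] i))

  adj-W : ∀ a d → d < M → adj G (W a) (W (d + a)) ≡ (1 ≤ᵇ d) ∧ (d ≤ᵇ k)
  adj-W a zero _ = irrefl G (W a)
  -- For k < d the vertex W (d + a) reaches W (M + a) = W a within k steps.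
  adj-W a (suc e) d<M with suc e ≤ᵇ k | ≤ᵇ-reflects-≤ (suc e) k
  ... | true | ofʸ d≤k = window⁺ (m<n+m a (s≤s z≤n)) (+-monoˡ-≤ a d≤k)
  ... | false | ofⁿ d≰k = ⟶⇒adj-false (subst (W (suc e + a) ⟶_) (W-period a)
        (window⁺ (+-monoˡ-< a d<M) (subst (M + a ≤_) (+-assoc k (suc e) a) (+-monoˡ-≤ a M≤k+d))))
    where
    M≤k+d : M ≤ k + suc e
    M≤k+d = subst (_≤ k + suc e) (M≡k+1+k k) (+-monoʳ-≤ k (≰⇒> d≰k))
      where
      M≡k+1+k : ∀ k → k + suc k ≡ suc (2 * k)
      M≡k+1+k = solve-∀

  Tadj-W : ∀ (i j : Fin M) → Tadj k i j ≡ adj G (W (toℕ i)) (W (toℕ j))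
  Tadj-W i j = begin
    Tadj k i j                           ≡⟨ adj-W (toℕ i) (gap i j) (gap< i j) ⟨
    adj G (W (toℕ i)) (W (gap i j + toℕ i)) ≡⟨ cong (adj G (W (toℕ i))) (trans (W-mod _) (cong W (gap-spec i j))) ⟩
    adj G (W (toℕ i)) (W (toℕ j))        ∎
    where open ≡-Reasoning

module PrimeD4Free {n} (G : Tournament n) (3≤n : 3 ≤ n) (prime : Prime G)
                   (D4-free : ¬ ContainsSub G D4adj) where

  open TournamentFacts G

  no-dominated-cyclic-triangle : ∀ {x a b c} → x ⟶ a → x ⟶ b → x ⟶ c → a ⟶ b → b ⟶ c → c ⟶ a → ⊥
  no-dominated-cyclic-triangle x⟶a x⟶b x⟶c a⟶b b⟶c c⟶a =
    D4-free (dominated-cyclic-triangle⇒D4 x⟶a x⟶b x⟶c a⟶b b⟶c c⟶a)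

  has-out-neighbour : ∀ v → ∃[ y ] v ⟶ y
  has-out-neighbour v with any? (v ⟶?_)
  ... | yes found = found
  ... | no none with two-others 3≤n v
  ...   | a , b , a≢b , a≢v , b≢v =
    ⊥-elim (prime⇒homogeneousᴾ-trivial prime (λ z → ¬? (z ≟ᶠ v)) beaten-by-others
             a≢v b≢v a≢b (λ v≢v → v≢v refl))
    where
    beaten-by-others : Homogeneousᴾ (_≢ v)
    beaten-by-others z ¬z≢v with decidable-stable (z ≟ᶠ v) ¬z≢v
    ... | refl = inj₂ λ x x≢v → case ⟶-total x≢v of λ
      { (inj₁ x⟶v) → x⟶v
      ; (inj₂ v⟶x) → contradiction (x , v⟶x) none }

  out-source : ∀ v → ∃[ s ] v ⟶ s × (∀ y → v ⟶ y → y ≢ s → s ⟶ y)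
  out-source v = source (v ⟶?_) (no-dominated-cyclic-triangle {v}) (proj₂ (has-out-neighbour v))

  -- Opaque so that the type checker never unfolds these choices into the search computing them.
  opaque
    σ : Fin n → Fin n
    σ v = proj₁ (out-source v)

    ⟶σ : ∀ v → v ⟶ σ v
    ⟶σ v = proj₁ (proj₂ (out-source v))

    σ-source : ∀ v y → v ⟶ y → y ≢ σ v → σ v ⟶ y
    σ-source v = proj₂ (proj₂ (out-source v))

  beats-predecessor : ∀ {w t t′ z} → w ⟶ t → t ⟶ z → z ⟶ w → t′ ⟶ t → t′ ⟶ z → w ≢ t′ → w ⟶ t′
  beats-predecessor w⟶t t⟶z z⟶w t′⟶t t′⟶z w≢t′ with ⟶-total w≢t′
  ... | inj₁ w⟶t′ = w⟶t′
  ... | inj₂ t′⟶w = ⊥-elim (no-dominated-cyclic-triangle t′⟶t t′⟶z t′⟶w t⟶z z⟶w w⟶t)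

  domination-spreads : ∀ {u s a z y} → u ⟶ s → s ⟶ a → a ⟶ u →
                       u ⟶ z → s ⟶ z → a ⟶ z → z ⟶ y → u ⟶ y
  domination-spreads u⟶s s⟶a a⟶u u⟶z s⟶z a⟶z z⟶y with ⟶-total (⟶⟶⇒≢ u⟶z z⟶y)
  ... | inj₁ u⟶y = u⟶y
  ... | inj₂ y⟶u = ⊥-elim (no-dominated-cyclic-triangle y⟶u y⟶s y⟶a u⟶s s⟶a a⟶u)
    where
    y⟶a = beats-predecessor y⟶u u⟶z z⟶y a⟶u a⟶z (⟶⟶⇒≢ a⟶z z⟶y ∘ sym)
    y⟶s = beats-predecessor y⟶a a⟶z z⟶y s⟶a s⟶z (⟶⟶⇒≢ s⟶z z⟶y ∘ sym)

  cyclic-triangle-no-common-out-neighbour : ∀ {u s a x} → u ⟶ s → s ⟶ a → a ⟶ u →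
                                            u ⟶ x → s ⟶ x → a ⟶ x → ⊥
  cyclic-triangle-no-common-out-neighbour {u} {s} {a} u⟶s s⟶a a⟶u u⟶x s⟶x a⟶x =
    prime⇒homogeneousᴾ-trivial prime (¬? ∘ Dominated?) spreads
      (⟶-irrefl ∘ proj₁) (⟶-irrefl ∘ proj₁ ∘ proj₂) (⟶⇒≢ u⟶s) (λ ¬dom → ¬dom (u⟶x , s⟶x , a⟶x))
    where
    Dominated : Fin n → Set
    Dominated z = u ⟶ z × s ⟶ z × a ⟶ z
    Dominated? : ∀ z → Dec (Dominated z)
    Dominated? z = (u ⟶? z) ×-dec (s ⟶? z) ×-dec (a ⟶? z)
    spreads : Homogeneousᴾ (¬_ ∘ Dominated)
    spreads z ¬¬dom with decidable-stable (Dominated? z) ¬¬dom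
    ... | u⟶z , s⟶z , a⟶z = inj₂ λ y ¬dom → case ⟶-total (λ { refl → ¬dom (u⟶z , s⟶z , a⟶z) }) of λ
      { (inj₁ y⟶z) → y⟶z
      ; (inj₂ z⟶y) → contradiction
          ( domination-spreads u⟶s s⟶a a⟶u u⟶z s⟶z a⟶z z⟶y
          , domination-spreads s⟶a a⟶u u⟶s s⟶z a⟶z u⟶z z⟶y
          , domination-spreads a⟶u u⟶s s⟶a a⟶z u⟶z s⟶z z⟶y ) ¬dom }

  σ-back : ∀ v → ∃[ a ] σ v ⟶ a × a ⟶ v
  σ-back v with any? (λ a → (σ v ⟶? a) ×-dec (a ⟶? v))
  ... | yes found = found
  ... | no none with avoid-two 3≤n v (σ v)
  ...   | c , c≢v , c≢σv = ⊥-elim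
    (prime⇒homogeneousᴾ-trivial prime (λ z → (z ≟ᶠ v) ⊎-dec (z ≟ᶠ σ v)) pair-homogeneous
      (inj₁ refl) (inj₂ refl) (⟶⇒≢ (⟶σ v)) [ c≢v , c≢σv ])
    where
    pair-homogeneous : Homogeneousᴾ (λ z → z ≡ v ⊎ z ≡ σ v)
    pair-homogeneous z z∉ with ⟶-total (z∉ ∘ inj₁ ∘ sym)
    ... | inj₁ v⟶z = inj₂ λ
      { _ (inj₁ refl) → v⟶z
      ; _ (inj₂ refl) → σ-source v z v⟶z (z∉ ∘ inj₂) }
    ... | inj₂ z⟶v = inj₁ λ
      { _ (inj₁ refl) → z⟶v
      ; _ (inj₂ refl) → case ⟶-total (z∉ ∘ inj₂) of λ
          { (inj₁ z⟶σv) → z⟶σv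
          ; (inj₂ σv⟶z) → contradiction (z , σv⟶z , z⟶v) none } }

  σ^ : ℕ → Fin n → Fin n
  σ^ zero v = v
  σ^ (suc i) v = σ (σ^ i v)

  σ^-+ : ∀ i j v → σ^ (i + j) v ≡ σ^ i (σ^ j v)
  σ^-+ zero j v = refl
  σ^-+ (suc i) j v = cong σ (σ^-+ i j v)

  σ^-suc : ∀ t v → σ^ (suc t) v ≡ σ^ t (σ v)
  σ^-suc zero v = refl
  σ^-suc (suc t) v = cong σ (σ^-suc t v)

  module Enumeration (v : Fin n) where

    Remaining : ℕ → Subset n
    Remaining zero = ⟦ v ⟶?_ ⟧
    Remaining (suc j) = Remaining j - σ^ (suc j) v

    Remaining⊆out : ∀ j {x} → x ∈ Remaining j → v ⟶ x
    Remaining⊆out zero x∈ = ∈⟦⟧⁻ (v ⟶?_) x∈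
    Remaining⊆out (suc j) {x} x∈ = Remaining⊆out j (p─q⊆p (Remaining j) _ x∈)

    removed : ∀ j {x} → v ⟶ x → x ∉ Remaining j → ∃[ i ] 1 ≤ i × i ≤ j × x ≡ σ^ i v
    removed zero v⟶x x∉ = contradiction (∈⟦⟧⁺ (v ⟶?_) v⟶x) x∉
    removed (suc j) {x} v⟶x x∉ with x ∈? Remaining j
    ... | yes x∈ = suc j , s≤s z≤n , ≤-refl ,
                   decidable-stable (x ≟ᶠ σ^ (suc j) v) (x∉ ∘ x∈p∧x≢y⇒x∈p-y x∈)
    ... | no x∉′ with removed j v⟶x x∉′
    ...   | i , 1≤i , i≤j , x≡ = i , 1≤i , m≤n⇒m≤1+n i≤j , x≡

    Invariant : ℕ → Set
    Invariant j = (∀ x → x ∈ Remaining j → σ^ j v ⟶ x) ×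
                  (∀ x y → x ∈ Remaining j → σ^ j v ⟶ y → y ∉ Remaining j → x ⟶ y)

    invariant : ∀ j → Invariant j
    invariant zero = (λ _ → ∈⟦⟧⁻ (v ⟶?_)) , λ _ y _ v⟶y y∉ → contradiction (∈⟦⟧⁺ (v ⟶?_) v⟶y) y∉
    invariant (suc j) = s-beats-remaining , remaining-beats-rest
      where
      u = σ^ j v
      s = σ u
      u-beats-remaining = proj₁ (invariant j)
      s-beats-remaining : ∀ x → x ∈ Remaining (suc j) → s ⟶ x
      s-beats-remaining x x∈ =
        σ-source u x (u-beats-remaining x (p─q⊆p (Remaining j) _ x∈)) (x∈p-y⇒x≢y x∈)
      remaining-beats-rest : ∀ x y → x ∈ Remaining (suc j) → s ⟶ y → y ∉ Remaining (suc j) → x ⟶ y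
      remaining-beats-rest x y x∈ s⟶y y∉ with y ∈? Remaining j | u ⟶? y
      ... | yes y∈ | _ = contradiction (subst (s ⟶_) y≡s s⟶y) ⟶-irrefl
        where
        y≡s : y ≡ s
        y≡s = decidable-stable (y ≟ᶠ s) (y∉ ∘ x∈p∧x≢y⇒x∈p-y y∈)
      ... | no y∉′ | yes u⟶y = proj₂ (invariant j) x y x∈′ u⟶y y∉′
        where x∈′ = p─q⊆p (Remaining j) _ x∈
      ... | no y∉′ | no ¬u⟶y with ⟶-total (λ { refl → y∉′ (p─q⊆p (Remaining j) _ x∈) })
      ...   | inj₁ x⟶y = x⟶y
      ...   | inj₂ y⟶x = ⊥-elim (cyclic-triangle-no-common-out-neighbour (⟶σ u) s⟶y y⟶u
                (u-beats-remaining x (p─q⊆p (Remaining j) _ x∈)) (s-beats-remaining x x∈) y⟶x)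
        where
        y⟶u : y ⟶ u
        y⟶u = case ⟶-total (⟶⟶⇒≢ (⟶σ u) s⟶y ∘ sym) of λ
          { (inj₁ y⟶u) → y⟶u
          ; (inj₂ u⟶y) → contradiction u⟶y ¬u⟶y }

    next-remaining : ∀ j {x} → x ∈ Remaining j → σ^ (suc j) v ∈ Remaining j
    next-remaining j {x} x∈ with σ^ (suc j) v ∈? Remaining j
    ... | yes s∈ = s∈
    ... | no s∉ = ⊥-elim (⟶-asym (proj₂ (invariant j) x s x∈ (⟶σ u) s∉)
                                 (σ-source u x (proj₁ (invariant j) x x∈) (λ { refl → s∉ x∈ })))
      where
      u = σ^ j v
      s = σ u

    exhaust : ∀ fuel j → ∣ Remaining j ∣ < fuel → (∀ i → 1 ≤ i → i ≤ j → v ⟶ σ^ i v) →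
              ∃[ k ] OutSegment v (λ i → σ^ i v) k
    exhaust (suc fuel) j ∣R∣<fuel first with nonempty? (Remaining j)
    ... | no empty = j , first , λ x v⟶x → removed j v⟶x (λ x∈ → empty (x , x∈))
    ... | yes (x , x∈) =
      exhaust fuel (suc j) (<-≤-trans (x∈p⇒∣p-x∣<∣p∣ s∈) (s≤s⁻¹ ∣R∣<fuel)) first′
      where
      s∈ = next-remaining j x∈
      first′ : ∀ i → 1 ≤ i → i ≤ suc j → v ⟶ σ^ i v
      first′ i 1≤i i≤1+j with m≤n⇒m<n∨m≡n i≤1+j
      ... | inj₁ i<1+j = first i 1≤i (s≤s⁻¹ i<1+j)
      ... | inj₂ refl = Remaining⊆out j s∈

  out-segment : ∀ v → ∃[ k ] OutSegment v (λ i → σ^ i v) k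
  out-segment v = exhaust (suc ∣ Remaining 0 ∣) 0 ≤-refl (λ i 1≤i i≤0 → contradiction i≤0 (<⇒≱ 1≤i))
    where open Enumeration v

  opaque
    width : Fin n → ℕ
    width v = proj₁ (out-segment v)

    width-segment : ∀ v → OutSegment v (λ i → σ^ i v) (width v)
    width-segment v = proj₂ (out-segment v)

  -- σ v ⟶ a ⟶ v puts a = σᵗ (σ v) = σ¹⁺ᵗ v with t ≤ width (σ v), and a cannot lie in N⁺(v).
  width≤width-σ : ∀ v → width v ≤ width (σ v)
  width≤width-σ v with σ-back v
  ... | a , σv⟶a , a⟶v with proj₂ (width-segment (σ v)) a σv⟶a
  ...   | t , _ , t≤ , a≡ with suc t ≤? width v
  ...     | yes 1+t≤ = contradiction a⟶v (⟶-asym (subst (v ⟶_) (trans (σ^-suc t v) (sym a≡))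
                                                      (proj₁ (width-segment v) (suc t) (s≤s z≤n) 1+t≤)))
  ...     | no 1+t≰ = ≤-trans (s≤s⁻¹ (≰⇒> 1+t≰)) t≤

  opaque
    w₀ : Fin n
    w₀ = argmax width (fromℕ< (≤-trans (s≤s z≤n) 3≤n)) (allFin n)

    width≤width-w₀ : ∀ v → width v ≤ width w₀
    width≤width-w₀ v = All.lookup (f[xs]≤f[argmax] _ (allFin n)) (∈-allFin v)

  W : ℕ → Fin n
  W j = σ^ j w₀

  k : ℕ
  k = width w₀

  width-W : ∀ j → width (W j) ≡ k
  width-W j = ≤-antisym (width≤width-w₀ (W j)) (k≤width-W j)
    where
    k≤width-W : ∀ j → k ≤ width (W j)
    k≤width-W zero = ≤-refl
    k≤width-W (suc j) = ≤-trans (k≤width-W j) (width≤width-σ (W j))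

  window : ∀ j → OutSegment (W j) (λ i → W (i + j)) k
  window j = subst (OutSegment (W j) (λ i → W (i + j))) (width-W j)
    (OutSegment-cong (λ i → sym (σ^-+ i j w₀)) (width-segment (W j)))

  1≤k : 1 ≤ k
  1≤k = let (y , w₀⟶y) = has-out-neighbour w₀
            (i , 1≤i , i≤k , _) = proj₂ (window 0) y w₀⟶y
        in ≤-trans 1≤i i≤k

  open Rotation G k 1≤k W window

  W-onto : ∀ x → ∃[ i ] W (toℕ i) ≡ x
  W-onto = out-closed⇒full prime (λ x → any? (λ i → W (toℕ i) ≟ᶠ x)) out-closed
    (zero , refl) (W-in-range 1) (W-≢ (s≤s z≤n) (≤-trans 1≤k (m≤m+n k _)))
    where
    out-closed : ∀ {y z} → ∃[ i ] W (toℕ i) ≡ y → y ⟶ z → ∃[ i ] W (toℕ i) ≡ z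
    out-closed (i , Wi≡y) y⟶z with window⁻ {toℕ i} (subst (_⟶ _) (sym Wi≡y) y⟶z)
    ... | b , _ , _ , z≡Wb = let (i′ , Wi′≡Wb) = W-in-range b in i′ , trans Wi′≡Wb (sym z≡Wb)

  isomorphic-to-T : Σ ℕ (λ k → (1 ≤ k) × IsoTo G (Tadj k))
  isomorphic-to-T = k , 1≤k , enumeration⇒IsoTo (λ i → W (toℕ i)) W-injective W-onto Tadj-W

T-D4-free : ∀ {n} (G : Tournament n) → Σ ℕ (λ k → (1 ≤ k) × IsoTo G (Tadj k)) → ¬ ContainsSub G D4adj
T-D4-free G (k , _ , φ , preserves) (f , _ , embeds) =
  <-irrefl refl (<-trans (ordered (# 1) (# 2) refl refl refl)
                (<-trans (ordered (# 2) (# 3) refl refl refl) (ordered (# 3) (# 1) refl refl refl)))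
  where
  p : Fin 4 → Fin (suc (2 * k))
  p i = Bijection.to φ (f i)
  T-edge : ∀ i j → D4adj i j ≡ true → Tadj k (p i) (p j) ≡ true
  T-edge i j e = trans (preserves (f i) (f j)) (trans (embeds i j) e)
  ordered : ∀ a b → D4adj (# 0) a ≡ true → D4adj (# 0) b ≡ true → D4adj a b ≡ true →
            gap (p (# 0)) (p a) < gap (p (# 0)) (p b)
  ordered a b 0a 0b ab =
    Tadj-out-ordered k (p (# 0)) (p a) (p b) (T-edge (# 0) a 0a) (T-edge (# 0) b 0b) (T-edge a b ab)

theorem3p8 : (n : ℕ) (G : Tournament n) → 3 ≤ n → Prime G →
    (¬ ContainsSub G D4adj) ⇔ Σ ℕ (λ k → (1 ≤ k) × IsoTo G (Tadj k))
theorem3p8 n G 3≤n prime = mk⇔ (PrimeD4Free.isomorphic-to-T G 3≤n prime) (T-D4-free G)
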